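{- Let $q\ge2$ be an integer (the residue field cardinality of a nonarchimedean local field). Let $R$ be the free $\mathbb{Z}$-algebra on the non-commuting variables $v,x,y_1,y_2$, and let $I$ be the two-sided ideal of $R$ generated by \begin{align*} r_1&=vx-xv,\qquad r_2=vy_1-y_2v,\qquad r_3=vy_2-y_1v,\\ r_4&=xy_1-y_1x+(1-q^2)vy_1-(1-q^2)vy_2,\\ r_5&=xy_2-y_2x-(1-q^2)vy_1+(1-q^2)vy_2,\\ r_6&=y_1y_2-y_2y_1-(q-1)^2(q+1)v^2y_1+(q-1)^2(q+1)v^2y_2+(q-1)vxy_1-(q-1)vxy_2,\\ r_7&=y_1y_2+q^2(q+1)^2v^4+q(q^2-1)v^3x-qv^2x^2-(q-1)vxy_2+q(q+1)v^2y_1+(1+q^3)v^2y_2. \end{align*} For $m\in R$ write $\bar m=m+I$. Then $R/I$ is spanned over $\mathbb{Z}$ by the elements $\bar v^a\bar x^b\bar y_1^{c_1}\bar y_2^{c_2}$ with $a,b,c_1,c_2\in\mathbb{Z}_{\ge0}$ and $c_1=0$ or $c_2=0$. -}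

module Defs where

open import Data.Nat using (ℕ; zero; suc)
open import Data.Integer using (ℤ; +_; -[1+_]; _-_; _*_) renaming (_+_ to _+ℤ_)
open import Data.List using (List; foldr)
open import Data.Product using (_×_; _,_)
open import Data.Sum using (_⊎_)
open import Relation.Binary.PropositionalEquality using (_≡_)

data Gen : Set where
  v x y₁ y₂ : Gen

-- Terms of the free (unital, associative, non-commutative) ring on Gen.
-- A ℤ-algebra is the same thing as a ring, so the free ℤ-algebra on Gen
-- is the set of these terms modulo the ring axioms.
infixl 6 _⊕_
infixl 7 _⊗_
data Term : Set where
  gen : Gen → Term
  𝟘 𝟙 : Term
  _⊕_ _⊗_ : Term → Term → Term
  ⊖_ : Term → Term

_⊝_ : Term → Term → Term
a ⊝ b = a ⊕ ⊖ b
infixl 6 _⊝_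

natmul : ℕ → Term → Term
natmul zero    t = 𝟘
natmul (suc n) t = t ⊕ natmul n t

_·_ : ℤ → Term → Term
(+ n)    · t = natmul n t
-[1+ n ] · t = ⊖ natmul (suc n) t
infixr 8 _·_

pow : Term → ℕ → Term
pow t zero    = 𝟙
pow t (suc n) = t ⊗ pow t n

V X Y₁ Y₂ : Term
V = gen v
X = gen x
Y₁ = gen y₁
Y₂ = gen y₂

module Rels (q : ℕ) where
  Q : ℤ
  Q = + q
  1ℤ : ℤ
  1ℤ = + 1

  r₁ r₂ r₃ r₄ r₅ r₆ r₇ : Term
  r₁ = V ⊗ X ⊝ X ⊗ V
  r₂ = V ⊗ Y₁ ⊝ Y₂ ⊗ V
  r₃ = V ⊗ Y₂ ⊝ Y₁ ⊗ V
  r₄ = X ⊗ Y₁ ⊝ Y₁ ⊗ X ⊕ (1ℤ - Q * Q) · (V ⊗ Y₁) ⊝ (1ℤ - Q * Q) · (V ⊗ Y₂)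
  r₅ = X ⊗ Y₂ ⊝ Y₂ ⊗ X ⊝ (1ℤ - Q * Q) · (V ⊗ Y₁) ⊕ (1ℤ - Q * Q) · (V ⊗ Y₂)
  r₆ = Y₁ ⊗ Y₂ ⊝ Y₂ ⊗ Y₁
       ⊝ ((Q - 1ℤ) * (Q - 1ℤ) * (Q +ℤ 1ℤ)) · (pow V 2 ⊗ Y₁)
       ⊕ ((Q - 1ℤ) * (Q - 1ℤ) * (Q +ℤ 1ℤ)) · (pow V 2 ⊗ Y₂)
       ⊕ (Q - 1ℤ) · (V ⊗ X ⊗ Y₁)
       ⊝ (Q - 1ℤ) · (V ⊗ X ⊗ Y₂)
  r₇ = Y₁ ⊗ Y₂
       ⊕ (Q * Q * (Q +ℤ 1ℤ) * (Q +ℤ 1ℤ)) · pow V 4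
       ⊕ (Q * (Q * Q - 1ℤ)) · (pow V 3 ⊗ X)
       ⊝ Q · (pow V 2 ⊗ pow X 2)
       ⊝ (Q - 1ℤ) · (V ⊗ X ⊗ Y₂)
       ⊕ (Q * (Q +ℤ 1ℤ)) · (pow V 2 ⊗ Y₁)
       ⊕ (1ℤ +ℤ Q * Q * Q) · (pow V 2 ⊗ Y₂)

-- Equality in R/I: the smallest congruence on terms containing the ring
-- axioms (giving R) and r_i ≈ 0 (giving the quotient by the two-sided ideal I).
module _ (q : ℕ) where
  open Rels q
  infix 4 _≈_
  data _≈_ : Term → Term → Set where
    refl  : ∀ {a} → a ≈ a
    sym   : ∀ {a b} → a ≈ b → b ≈ a
    trans : ∀ {a b c} → a ≈ b → b ≈ c → a ≈ c
    ⊕-cong : ∀ {a a' b b'} → a ≈ a' → b ≈ b' → a ⊕ b ≈ a' ⊕ b'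
    ⊗-cong : ∀ {a a' b b'} → a ≈ a' → b ≈ b' → a ⊗ b ≈ a' ⊗ b'
    ⊖-cong : ∀ {a a'} → a ≈ a' → ⊖ a ≈ ⊖ a'
    ⊕-assoc : ∀ a b c → (a ⊕ b) ⊕ c ≈ a ⊕ (b ⊕ c)
    ⊕-comm  : ∀ a b → a ⊕ b ≈ b ⊕ a
    ⊕-idˡ   : ∀ a → 𝟘 ⊕ a ≈ a
    ⊖-invˡ  : ∀ a → (⊖ a) ⊕ a ≈ 𝟘
    ⊗-assoc : ∀ a b c → (a ⊗ b) ⊗ c ≈ a ⊗ (b ⊗ c)
    ⊗-idˡ   : ∀ a → 𝟙 ⊗ a ≈ a
    ⊗-idʳ   : ∀ a → a ⊗ 𝟙 ≈ a
    distribˡ : ∀ a b c → a ⊗ (b ⊕ c) ≈ a ⊗ b ⊕ a ⊗ c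
    distribʳ : ∀ a b c → (b ⊕ c) ⊗ a ≈ b ⊗ a ⊕ c ⊗ a
    rel₁ : r₁ ≈ 𝟘
    rel₂ : r₂ ≈ 𝟘
    rel₃ : r₃ ≈ 𝟘
    rel₄ : r₄ ≈ 𝟘
    rel₅ : r₅ ≈ 𝟘
    rel₆ : r₆ ≈ 𝟘
    rel₇ : r₇ ≈ 𝟘

record Mono : Set where
  constructor mono
  field
    a b c₁ c₂ : ℕ
    restr : c₁ ≡ 0 ⊎ c₂ ≡ 0

monoTerm : Mono → Term
monoTerm (mono a b c₁ c₂ _) = pow V a ⊗ pow X b ⊗ pow Y₁ c₁ ⊗ pow Y₂ c₂

lincomb : List (ℤ × Mono) → Term
lincomb = foldr (λ { (c , m) acc → c · monoTerm m ⊕ acc }) 𝟘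

{-# OPTIONS --safe #-}

-- Left multiplication by every generator maps the ℤ-span of the normal monomials
-- vᵃ xᵇ yⱼᶜ into itself; since every word is such a product applied to 1, it lies in
-- the span. For v this is immediate, for x it follows from vx = xv (r₁). A letter yᵢ
-- passes vᵃ turning into y₁ or y₂ according to the parity of a (r₂, r₃), and then meets
-- xᵇ yⱼᶜ: by r₄, r₅ the product yᵢx is x yᵢ plus multiples of v y₁ and v y₂, which gives
-- an induction on b, and for b = 0 the products y₁y₂ and y₂y₁ are rewritten by r₇ and
-- r₆ into words in v, x followed by one y, which gives an induction on c.

module Submission where

open import Defs hiding (_≈_)
import Defs
open import Algebra.Bundles using (Ring)
import Algebra.Properties.Ring as RingProperties
open import Data.Integer using (ℤ; +_; -[1+_]; -_; _+_; _-_; _*_)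
open import Data.List using (List; []; _∷_; _++_; map)
open import Data.Nat using (ℕ; zero; suc; _≤_)
open import Data.Nat.GeneralisedArithmetic using (iterate)
open import Data.Product using (Σ; _×_; _,_; map₁)
open import Data.Sum using (inj₁; inj₂)
open import Data.Unit using (tt)
open import Function using (id)
open import Level using (0ℓ)
open import Relation.Binary.Definitions using (_Respects_)
open import Relation.Binary.PropositionalEquality using (refl)

module Quotient (q : ℕ) where
  open Rels q

  infix 4 _≈_
  _≈_ : Term → Term → Set
  _≈_ = Defs._≈_ q

  quotientRing : Ring 0ℓ 0ℓ
  quotientRing = record
    { Carrier = Term
    ; _≈_ = _≈_
    ; _+_ = _⊕_
    ; _*_ = _⊗_
    ; -_ = ⊖_
    ; 0# = 𝟘
    ; 1# = 𝟙
    ; isRing = record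
      { +-isAbelianGroup = record
        { isGroup = record
          { isMonoid = record
            { isSemigroup = record
              { isMagma = record
                { isEquivalence = record { refl = refl ; sym = sym ; trans = trans }
                ; ∙-cong = ⊕-cong
                }
              ; assoc = ⊕-assoc
              }
            ; identity = ⊕-idˡ , λ a → trans (⊕-comm a 𝟘) (⊕-idˡ a)
            }
          ; inverse = ⊖-invˡ , λ a → trans (⊕-comm a (⊖ a)) (⊖-invˡ a)
          ; ⁻¹-cong = ⊖-cong
          }
        ; comm = ⊕-comm
        }
      ; *-cong = ⊗-cong
      ; *-assoc = ⊗-assoc
      ; *-identity = ⊗-idˡ , ⊗-idʳ
      ; distrib = distribˡ , distribʳ
      }
    }

  open Ring quotientRing using (setoid; zeroˡ; zeroʳ; +-identityʳ)
  open RingProperties quotientRing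
    using (-‿distribˡ-*; -‿distribʳ-*; -‿involutive; -‿+-comm; -0#≈0#; x∙y⁻¹≈ε⇒x≈y)
  open import Relation.Binary.Reasoning.Setoid setoid

  natmul-comm-⊗ : ∀ n a b → a ⊗ natmul n b ≈ natmul n (a ⊗ b)
  natmul-comm-⊗ zero    a b = zeroʳ a
  natmul-comm-⊗ (suc n) a b = trans (distribˡ a b _) (⊕-cong refl (natmul-comm-⊗ n a b))

  ·-comm-⊗ : ∀ c a b → a ⊗ (c · b) ≈ c · (a ⊗ b)
  ·-comm-⊗ (+ n)    a b = natmul-comm-⊗ n a b
  ·-comm-⊗ -[1+ n ] a b = trans (sym (-‿distribʳ-* a _)) (⊖-cong (natmul-comm-⊗ (suc n) a b))

  -‿· : ∀ c a → (- c) · a ≈ ⊖ (c · a)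
  -‿· (+ zero)  a = sym -0#≈0#
  -‿· (+ suc n) a = refl
  -‿· -[1+ n ]  a = sym (-‿involutive _)

  record AdditiveSubgroup (P : Term → Set) : Set where
    field
      respects : P Respects _≈_
      𝟘-closed : P 𝟘
      ⊕-closed : ∀ {a b} → P a → P b → P (a ⊕ b)
      ⊖-closed : ∀ {a} → P a → P (⊖ a)

    natmul-closed : ∀ n {a} → P a → P (natmul n a)
    natmul-closed zero    pa = 𝟘-closed
    natmul-closed (suc n) pa = ⊕-closed pa (natmul-closed n pa)

    ·-closed : ∀ c {a} → P a → P (c · a)
    ·-closed (+ n)    pa = natmul-closed n pa
    ·-closed -[1+ n ] pa = ⊖-closed (natmul-closed (suc n) pa)

    ≈𝟘-closed : ∀ {a} → a ≈ 𝟘 → P a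
    ≈𝟘-closed a≈𝟘 = respects (sym a≈𝟘) 𝟘-closed

    ⊖-reflect : ∀ {a} → P (⊖ a) → P a
    ⊖-reflect {a} p = respects (-‿involutive a) (⊖-closed p)

    cancelˡ : ∀ {a b} → P (a ⊕ b) → P a → P b
    cancelˡ {a} {b} pab pa = respects a⊕b-a≈b (⊕-closed (⊖-closed pa) pab)
      where
      a⊕b-a≈b : ⊖ a ⊕ (a ⊕ b) ≈ b
      a⊕b-a≈b = begin
        ⊖ a ⊕ (a ⊕ b)  ≈⟨ ⊕-assoc (⊖ a) a b ⟨
        (⊖ a ⊕ a) ⊕ b  ≈⟨ ⊕-cong (⊖-invˡ a) refl ⟩
        𝟘 ⊕ b          ≈⟨ ⊕-idˡ b ⟩
        b              ∎

    cancelʳ : ∀ {a b} → P (a ⊕ b) → P b → P a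
    cancelʳ {a} {b} pab pb = cancelˡ (respects (⊕-comm a b) pab) pb

  ⊗ʳ-preimage : ∀ {P} → AdditiveSubgroup P → (W : Term) → AdditiveSubgroup (λ t → P (t ⊗ W))
  ⊗ʳ-preimage S W = record
    { respects = λ a≈b → respects (⊗-cong a≈b refl)
    ; 𝟘-closed = respects (sym (zeroˡ W)) 𝟘-closed
    ; ⊕-closed = λ {a} {b} pa pb → respects (sym (distribʳ W a b)) (⊕-closed pa pb)
    ; ⊖-closed = λ {a} pa → respects (-‿distribˡ-* a W) (⊖-closed pa)
    }
    where open AdditiveSubgroup S

  module Relations {P : Term → Set} (S : AdditiveSubgroup P) where
    open AdditiveSubgroup S

    Y₁⊗X-from-r₄ : P (X ⊗ Y₁) → P (V ⊗ Y₁) → P (V ⊗ Y₂) → P (Y₁ ⊗ X)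
    Y₁⊗X-from-r₄ pXY₁ pVY₁ pVY₂ =
      ⊖-reflect (cancelˡ (cancelʳ (cancelʳ (≈𝟘-closed rel₄)
        (⊖-closed (·-closed (1ℤ - Q * Q) pVY₂)))
        (·-closed (1ℤ - Q * Q) pVY₁))
        pXY₁)

    Y₂⊗X-from-r₅ : P (X ⊗ Y₂) → P (V ⊗ Y₁) → P (V ⊗ Y₂) → P (Y₂ ⊗ X)
    Y₂⊗X-from-r₅ pXY₂ pVY₁ pVY₂ =
      ⊖-reflect (cancelˡ (cancelʳ (cancelʳ (≈𝟘-closed rel₅)
        (·-closed (1ℤ - Q * Q) pVY₂))
        (⊖-closed (·-closed (1ℤ - Q * Q) pVY₁)))
        pXY₂)

    Y₁⊗Y₂-from-r₇ : P (pow V 4) → P (pow V 3 ⊗ X) → P (pow V 2 ⊗ pow X 2) →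
                    P (V ⊗ X ⊗ Y₂) → P (pow V 2 ⊗ Y₁) → P (pow V 2 ⊗ Y₂) → P (Y₁ ⊗ Y₂)
    Y₁⊗Y₂-from-r₇ pV⁴ pV³X pV²X² pVXY₂ pV²Y₁ pV²Y₂ =
      cancelʳ (cancelʳ (cancelʳ (cancelʳ (cancelʳ (cancelʳ (≈𝟘-closed rel₇)
        (·-closed (1ℤ + Q * Q * Q) pV²Y₂))
        (·-closed (Q * (Q + 1ℤ)) pV²Y₁))
        (⊖-closed (·-closed (Q - 1ℤ) pVXY₂)))
        (⊖-closed (·-closed Q pV²X²)))
        (·-closed (Q * (Q * Q - 1ℤ)) pV³X))
        (·-closed (Q * Q * (Q + 1ℤ) * (Q + 1ℤ)) pV⁴)

    Y₂⊗Y₁-from-r₆ : P (Y₁ ⊗ Y₂) → P (pow V 2 ⊗ Y₁) → P (pow V 2 ⊗ Y₂) →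
                    P (V ⊗ X ⊗ Y₁) → P (V ⊗ X ⊗ Y₂) → P (Y₂ ⊗ Y₁)
    Y₂⊗Y₁-from-r₆ pY₁Y₂ pV²Y₁ pV²Y₂ pVXY₁ pVXY₂ =
      ⊖-reflect (cancelˡ (cancelʳ (cancelʳ (cancelʳ (cancelʳ (≈𝟘-closed rel₆)
        (⊖-closed (·-closed (Q - 1ℤ) pVXY₂)))
        (·-closed (Q - 1ℤ) pVXY₁))
        (·-closed ((Q - 1ℤ) * (Q - 1ℤ) * (Q + 1ℤ)) pV²Y₂))
        (⊖-closed (·-closed ((Q - 1ℤ) * (Q - 1ℤ) * (Q + 1ℤ)) pV²Y₁)))
        pY₁Y₂)

  Spanned : Term → Set
  Spanned t = Σ (List (ℤ × Mono)) λ cs → t ≈ lincomb cs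

  lincomb-++ : ∀ cs ds → lincomb (cs ++ ds) ≈ lincomb cs ⊕ lincomb ds
  lincomb-++ []             ds = sym (⊕-idˡ _)
  lincomb-++ ((c , m) ∷ cs) ds = trans (⊕-cong refl (lincomb-++ cs ds)) (sym (⊕-assoc _ _ _))

  lincomb-negate : ∀ cs → lincomb (map (map₁ (λ c → - c)) cs) ≈ ⊖ lincomb cs
  lincomb-negate []             = sym -0#≈0#
  lincomb-negate ((c , m) ∷ cs) =
    trans (⊕-cong (-‿· c _) (lincomb-negate cs)) (-‿+-comm _ _)

  spanned-subgroup : AdditiveSubgroup Spanned
  spanned-subgroup = record
    { respects = λ { a≈b (cs , a≈cs) → cs , trans (sym a≈b) a≈cs }
    ; 𝟘-closed = [] , refl
    ; ⊕-closed = λ { (cs , a≈cs) (ds , b≈ds) →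
        cs ++ ds , trans (⊕-cong a≈cs b≈ds) (sym (lincomb-++ cs ds)) }
    ; ⊖-closed = λ { (cs , a≈cs) →
        map (map₁ (λ c → - c)) cs , trans (⊖-cong a≈cs) (sym (lincomb-negate cs)) }
    }

  open AdditiveSubgroup spanned-subgroup

  monoTerm-spanned : ∀ m → Spanned (monoTerm m)
  monoTerm-spanned m = (+ 1 , m) ∷ [] , sym (trans (+-identityʳ _) (+-identityʳ _))

  data YIdx : Set where
    one two : YIdx

  Y[_] : YIdx → Term
  Y[ one ] = Y₁
  Y[ two ] = Y₂

  swap : YIdx → YIdx
  swap one = two
  swap two = one

  normal : ℕ → ℕ → YIdx → ℕ → Term
  normal a b j c = pow V a ⊗ (pow X b ⊗ pow Y[ j ] c)

  normal-spanned : ∀ a b j c → Spanned (normal a b j c)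
  normal-spanned a b one c =
    respects (trans (⊗-idʳ _) (⊗-assoc _ _ _)) (monoTerm-spanned (mono a b c 0 (inj₂ refl)))
  normal-spanned a b two c =
    respects (trans (⊗-cong (⊗-idʳ _) refl) (⊗-assoc _ _ _)) (monoTerm-spanned (mono a b 0 c (inj₁ refl)))

  Yᶜ-spanned : ∀ j c → Spanned (pow Y[ j ] c)
  Yᶜ-spanned j c = respects (trans (⊗-idˡ _) (⊗-idˡ _)) (normal-spanned 0 0 j c)

  monoTerm-viaNormal : ∀ {Q : Term → Set} → Q Respects _≈_ →
                       (∀ a b j c → Q (normal a b j c)) → ∀ m → Q (monoTerm m)
  monoTerm-viaNormal resp qn (mono a b _ c (inj₁ refl)) =
    resp (sym (trans (⊗-cong (⊗-idʳ _) refl) (⊗-assoc _ _ _))) (qn a b two c)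
  monoTerm-viaNormal resp qn (mono a b c _ (inj₂ refl)) =
    resp (sym (trans (⊗-idʳ _) (⊗-assoc _ _ _))) (qn a b one c)

  PreservesSpan : Term → Set
  PreservesSpan g = ∀ {s} → Spanned s → Spanned (g ⊗ s)

  preservesSpan-subgroup : AdditiveSubgroup PreservesSpan
  preservesSpan-subgroup = record
    { respects = λ g≈h pg ps → respects (⊗-cong g≈h refl) (pg ps)
    ; 𝟘-closed = λ {s} _ → respects (sym (zeroˡ s)) 𝟘-closed
    ; ⊕-closed = λ {a} {b} pa pb {s} ps →
        respects (sym (distribʳ s a b)) (⊕-closed (pa ps) (pb ps))
    ; ⊖-closed = λ {a} pa {s} ps → respects (-‿distribˡ-* a s) (⊖-closed (pa ps))
    }

  preservesSpan-𝟙 : PreservesSpan 𝟙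
  preservesSpan-𝟙 {s} = respects (sym (⊗-idˡ s))

  preservesSpan-⊗ : ∀ {g h} → PreservesSpan g → PreservesSpan h → PreservesSpan (g ⊗ h)
  preservesSpan-⊗ {g} {h} pg ph {s} ps = respects (sym (⊗-assoc g h s)) (pg (ph ps))

  preservesSpan-pow : ∀ {g} → PreservesSpan g → ∀ n → PreservesSpan (pow g n)
  preservesSpan-pow pg zero    = preservesSpan-𝟙
  preservesSpan-pow pg (suc n) = preservesSpan-⊗ pg (preservesSpan-pow pg n)

  preservesSpan-onNormal : ∀ {g} → (∀ a b j c → Spanned (g ⊗ normal a b j c)) → PreservesSpan g
  preservesSpan-onNormal {g} gn (cs , s≈cs) = respects (⊗-cong refl (sym s≈cs)) (onLincomb cs)
    where
    onLincomb : ∀ cs → Spanned (g ⊗ lincomb cs)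
    onLincomb []             = respects (sym (zeroʳ g)) 𝟘-closed
    onLincomb ((c , m) ∷ cs) =
      respects (sym (trans (distribˡ g _ _) (⊕-cong (·-comm-⊗ c g _) refl)))
        (⊕-closed (·-closed c (monoTerm-viaNormal (λ e → respects (⊗-cong refl e)) gn m))
                  (onLincomb cs))

  twistedComm-pow : ∀ {I : Set} (F : I → Term) (σ : I → I) {h} →
                    (∀ i → F i ⊗ h ≈ h ⊗ F (σ i)) → ∀ n i → F i ⊗ pow h n ≈ pow h n ⊗ F (iterate σ i n)
  twistedComm-pow F σ comm zero    i = trans (⊗-idʳ (F i)) (sym (⊗-idˡ (F i)))
  twistedComm-pow F σ {h} comm (suc n) i = begin
    F i ⊗ (h ⊗ pow h n)                    ≈⟨ ⊗-assoc _ _ _ ⟨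
    (F i ⊗ h) ⊗ pow h n                    ≈⟨ ⊗-cong (comm i) refl ⟩
    (h ⊗ F (σ i)) ⊗ pow h n                ≈⟨ ⊗-assoc _ _ _ ⟩
    h ⊗ (F (σ i) ⊗ pow h n)                ≈⟨ ⊗-cong refl (twistedComm-pow F σ comm n (σ i)) ⟩
    h ⊗ (pow h n ⊗ F (iterate σ (σ i) n))  ≈⟨ ⊗-assoc _ _ _ ⟨
    (h ⊗ pow h n) ⊗ F (iterate σ (σ i) n)  ∎

  X⊗Vⁿ : ∀ n → X ⊗ pow V n ≈ pow V n ⊗ X
  X⊗Vⁿ n = twistedComm-pow (λ _ → X) id (λ _ → sym (x∙y⁻¹≈ε⇒x≈y _ _ rel₁)) n tt

  Y⊗Vⁿ : ∀ n i → Y[ i ] ⊗ pow V n ≈ pow V n ⊗ Y[ iterate swap i n ]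
  Y⊗Vⁿ = twistedComm-pow Y[_] swap Y⊗V
    where
    Y⊗V : ∀ i → Y[ i ] ⊗ V ≈ V ⊗ Y[ swap i ]
    Y⊗V one = sym (x∙y⁻¹≈ε⇒x≈y _ _ rel₃)
    Y⊗V two = sym (x∙y⁻¹≈ε⇒x≈y _ _ rel₂)

  preservesSpan-V : PreservesSpan V
  preservesSpan-V = preservesSpan-onNormal λ a b j c →
    respects (⊗-assoc V (pow V a) _) (normal-spanned (suc a) b j c)

  preservesSpan-X : PreservesSpan X
  preservesSpan-X = preservesSpan-onNormal λ a b j c → respects (sym (begin
    X ⊗ (pow V a ⊗ (pow X b ⊗ pow Y[ j ] c))  ≈⟨ ⊗-assoc _ _ _ ⟨
    (X ⊗ pow V a) ⊗ (pow X b ⊗ pow Y[ j ] c)  ≈⟨ ⊗-cong (X⊗Vⁿ a) refl ⟩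
    (pow V a ⊗ X) ⊗ (pow X b ⊗ pow Y[ j ] c)  ≈⟨ ⊗-assoc _ _ _ ⟩
    pow V a ⊗ (X ⊗ (pow X b ⊗ pow Y[ j ] c))  ≈⟨ ⊗-cong refl (⊗-assoc _ _ _) ⟨
    normal a (suc b) j c                      ∎))
    (normal-spanned a (suc b) j c)

  preservesSpan-assoc : ∀ {g t W} → PreservesSpan g → Spanned (t ⊗ W) → Spanned (g ⊗ t ⊗ W)
  preservesSpan-assoc {g} {t} {W} pg ptW = respects (sym (⊗-assoc g t W)) (pg ptW)

  module _ (W : Term) (W-spanned : Spanned W)
           (Y₁W-spanned : Spanned (Y₁ ⊗ W)) (Y₂W-spanned : Spanned (Y₂ ⊗ W)) where
    open Relations (⊗ʳ-preimage spanned-subgroup W)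

    YW-spanned : ∀ i → Spanned (Y[ i ] ⊗ W)
    YW-spanned one = Y₁W-spanned
    YW-spanned two = Y₂W-spanned

    VYW-spanned : ∀ i → Spanned (V ⊗ Y[ i ] ⊗ W)
    VYW-spanned i = preservesSpan-assoc preservesSpan-V (YW-spanned i)

    V²YW-spanned : ∀ i → Spanned (pow V 2 ⊗ Y[ i ] ⊗ W)
    V²YW-spanned i = preservesSpan-assoc (preservesSpan-pow preservesSpan-V 2) (YW-spanned i)

    VXYW-spanned : ∀ i → Spanned (V ⊗ X ⊗ Y[ i ] ⊗ W)
    VXYW-spanned i = preservesSpan-assoc (preservesSpan-⊗ preservesSpan-V preservesSpan-X) (YW-spanned i)

    YXW-spanned : ∀ i → Spanned (Y[ i ] ⊗ X ⊗ W)
    YXW-spanned one = Y₁⊗X-from-r₄ (preservesSpan-assoc preservesSpan-X Y₁W-spanned)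
                                   (VYW-spanned one) (VYW-spanned two)
    YXW-spanned two = Y₂⊗X-from-r₅ (preservesSpan-assoc preservesSpan-X Y₂W-spanned)
                                   (VYW-spanned one) (VYW-spanned two)

    Y₁Y₂W-spanned : Spanned (Y₁ ⊗ Y₂ ⊗ W)
    Y₁Y₂W-spanned = Y₁⊗Y₂-from-r₇
      (preservesSpan-pow preservesSpan-V 4 W-spanned)
      (preservesSpan-⊗ (preservesSpan-pow preservesSpan-V 3) preservesSpan-X W-spanned)
      (preservesSpan-⊗ (preservesSpan-pow preservesSpan-V 2) (preservesSpan-pow preservesSpan-X 2) W-spanned)
      (VXYW-spanned two) (V²YW-spanned one) (V²YW-spanned two)

    Y₂Y₁W-spanned : Spanned (Y₂ ⊗ Y₁ ⊗ W)
    Y₂Y₁W-spanned = Y₂⊗Y₁-from-r₆ Y₁Y₂W-spanned (V²YW-spanned one) (V²YW-spanned two)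
                                  (VXYW-spanned one) (VXYW-spanned two)

  Y⊗Yᶜ-spanned : ∀ i j c → Spanned (Y[ i ] ⊗ pow Y[ j ] c)
  Y⊗Yᶜ-spanned i   j   zero    = Yᶜ-spanned i 1
  Y⊗Yᶜ-spanned one one (suc c) = Yᶜ-spanned one (suc (suc c))
  Y⊗Yᶜ-spanned two two (suc c) = Yᶜ-spanned two (suc (suc c))
  Y⊗Yᶜ-spanned one two (suc c) = respects (⊗-assoc _ _ _)
    (Y₁Y₂W-spanned (pow Y₂ c) (Yᶜ-spanned two c)
                   (Y⊗Yᶜ-spanned one two c) (Yᶜ-spanned two (suc c)))
  Y⊗Yᶜ-spanned two one (suc c) = respects (⊗-assoc _ _ _)
    (Y₂Y₁W-spanned (pow Y₁ c) (Yᶜ-spanned one c)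
                   (Yᶜ-spanned one (suc c)) (Y⊗Yᶜ-spanned two one c))

  Y⊗XᵇYᶜ-spanned : ∀ i b j c → Spanned (Y[ i ] ⊗ (pow X b ⊗ pow Y[ j ] c))
  Y⊗XᵇYᶜ-spanned i zero    j c = respects (⊗-cong refl (sym (⊗-idˡ _))) (Y⊗Yᶜ-spanned i j c)
  Y⊗XᵇYᶜ-spanned i (suc b) j c =
    respects (trans (⊗-assoc _ _ _) (⊗-cong refl (sym (⊗-assoc _ _ _))))
    (YXW-spanned (pow X b ⊗ pow Y[ j ] c) (preservesSpan-pow preservesSpan-X b (Yᶜ-spanned j c))
      (Y⊗XᵇYᶜ-spanned one b j c) (Y⊗XᵇYᶜ-spanned two b j c) i)

  preservesSpan-Y : ∀ i → PreservesSpan Y[ i ]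
  preservesSpan-Y i = preservesSpan-onNormal λ a b j c → respects (sym (begin
    Y[ i ] ⊗ (pow V a ⊗ (pow X b ⊗ pow Y[ j ] c))                 ≈⟨ ⊗-assoc _ _ _ ⟨
    (Y[ i ] ⊗ pow V a) ⊗ (pow X b ⊗ pow Y[ j ] c)                 ≈⟨ ⊗-cong (Y⊗Vⁿ a i) refl ⟩
    (pow V a ⊗ Y[ iterate swap i a ]) ⊗ (pow X b ⊗ pow Y[ j ] c)  ≈⟨ ⊗-assoc _ _ _ ⟩
    pow V a ⊗ (Y[ iterate swap i a ] ⊗ (pow X b ⊗ pow Y[ j ] c))  ∎))
    (preservesSpan-pow preservesSpan-V a (Y⊗XᵇYᶜ-spanned (iterate swap i a) b j c))

  preservesSpan : ∀ t → PreservesSpan t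
  preservesSpan (gen v)  = preservesSpan-V
  preservesSpan (gen x)  = preservesSpan-X
  preservesSpan (gen y₁) = preservesSpan-Y one
  preservesSpan (gen y₂) = preservesSpan-Y two
  preservesSpan 𝟘        = AdditiveSubgroup.𝟘-closed preservesSpan-subgroup
  preservesSpan 𝟙        = preservesSpan-𝟙
  preservesSpan (a ⊕ b)  = AdditiveSubgroup.⊕-closed preservesSpan-subgroup (preservesSpan a) (preservesSpan b)
  preservesSpan (a ⊗ b)  = preservesSpan-⊗ (preservesSpan a) (preservesSpan b)
  preservesSpan (⊖ a)    = AdditiveSubgroup.⊖-closed preservesSpan-subgroup (preservesSpan a)

  spanned : ∀ t → Spanned t
  spanned t = respects (⊗-idʳ t) (preservesSpan t (Yᶜ-spanned one 0))

open Defs using (_≈_)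

lemma3p9 : (q : ℕ) → 2 ≤ q → (t : Term) →
    Σ (List (ℤ × Mono)) (λ cs → _≈_ q t (lincomb cs))
lemma3p9 q _ = Quotient.spanned q
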